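{- Let $X$ be a countably infinite set and let $A\leq\operatorname{Sym}(X)$ have infinite minimal degree. Then there exists a subgroup $B\leq A$ such that $A=\operatorname{cl}_A(B)$ and $B$ is not strongly orbit-equivalent to any proper subgroup of $B$.
   Context: The minimal degree of $A$ is the minimum, over nonidentity $a\in A$, of $|\{x\in X:ax\neq x\}|$. $\operatorname{cl}_A(B)$ is the set of $a\in A$ such that for every finite $Y\subseteq X$ some $b\in B$ satisfies $ay=by$ for all $y\in Y$. Two groups $B,C\leq\operatorname{Sym}(X)$ are strongly orbit-equivalent if they have the same orbits on the power set of $X$. (Axiom of Choice assumed.) -}

module Defs where

open import Level using (Level; 0ℓ) renaming (suc to lsuc)
open import Data.Product using (Σ; ∃; _×_; _,_)
open import Data.List using (List)
open import Data.List.Membership.Propositional using (_∈_)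
open import Relation.Nullary using (¬_)
open import Relation.Unary using (Pred)
open import Relation.Binary.PropositionalEquality using (_≡_)
open import Function.Bundles using (_↔_; Inverse; _⇔_)
open import Function.Construct.Composition using (_↔-∘_)
open import Function.Construct.Identity using (↔-id)
open import Function.Construct.Symmetry using (↔-sym)

Sym : Set → Set
Sym X = X ↔ X

module _ {X : Set} where
  open Inverse

  _≈ₚ_ : Sym X → Sym X → Set
  a ≈ₚ b = ∀ x → to a x ≡ to b x

  record IsSubgroup (G : Pred (Sym X) 0ℓ) : Set where
    field
      respects : ∀ {a b} → a ≈ₚ b → G a → G b
      has-id   : G (↔-id X)
      closed-∘ : ∀ {a b} → G a → G b → G (a ↔-∘ b)
      closed-⁻¹ : ∀ {a} → G a → G (↔-sym a)

  _⊆ₚ_ : Pred (Sym X) 0ℓ → Pred (Sym X) 0ℓ → Set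
  H ⊆ₚ G = ∀ a → H a → G a

  Finite : Pred X 0ℓ → Set
  Finite S = Σ (List X) λ Y → ∀ x → S x → x ∈ Y

  Infinite : Pred X 0ℓ → Set
  Infinite S = ¬ Finite S

  support : Sym X → Pred X 0ℓ
  support a x = ¬ (to a x ≡ x)

  InfiniteMinimalDegree : Pred (Sym X) 0ℓ → Set
  InfiniteMinimalDegree A = ∀ a → A a → ¬ (a ≈ₚ ↔-id X) → Infinite (support a)

  cl : Pred (Sym X) 0ℓ → Pred (Sym X) 0ℓ → Pred (Sym X) 0ℓ
  cl A B a = A a × (∀ (Y : List X) → Σ (Sym X) λ b → B b × (∀ y → y ∈ Y → to a y ≡ to b y))

  SameSet : Pred (Sym X) 0ℓ → Pred (Sym X) 0ℓ → Set
  SameSet G H = (G ⊆ₚ H) × (H ⊆ₚ G)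

  MapsTo : Sym X → Pred X 0ℓ → Pred X 0ℓ → Set
  MapsTo a S T = ∀ y → T y ⇔ (Σ X λ x → S x × to a x ≡ y)

  StronglyOrbitEquivalent : Pred (Sym X) 0ℓ → Pred (Sym X) 0ℓ → Set₁
  StronglyOrbitEquivalent B C =
    ∀ (S T : Pred X 0ℓ) →
      (Σ (Sym X) λ b → B b × MapsTo b S T) ⇔ (Σ (Sym X) λ c → C c × MapsTo c S T)

  ProperSubgroup : Pred (Sym X) 0ℓ → Pred (Sym X) 0ℓ → Set
  ProperSubgroup C B = IsSubgroup C × (C ⊆ₚ B) × (Σ (Sym X) λ b → B b × ¬ C b)

-- Reading permutations through X ≅ ℕ, choose for every finite list p of naturals one element
-- of A whose values on 0,…,|p|−1 are given by p, if there is one.  The subgroup B these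
-- choices generate is countable and dense in A.  Enumerating B by finite lists of words, a
-- diagonal construction that uses the infinite supports produces S ⊆ X such that every
-- non-identity b ∈ B sends some point of S outside S.  If a proper subgroup C ≤ B had the
-- same orbits on subsets of X, then for b ∈ B ∖ C some c ∈ C would satisfy cS = bS, and the
-- non-identity element c⁻¹b ∈ B would map S into S.
module Submission where

open import Defs
open import Level using (0ℓ) renaming (suc to lsuc)
open import Data.Nat using (ℕ; zero; suc; _+_; _≤_; _<_; _≤′_; ≤′-refl; ≤′-step; s≤s; _⊔_)
open import Data.Nat.Properties using (≤-trans; ≤-refl; m≤m+n; m≤n+m; m≤m⊔n; m≤n⊔m; ≤-total; ≤⇒≤′)
open import Data.Nat.ListAction using (sum)
open import Data.Product using (Σ; _×_; _,_; proj₁; proj₂)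
open import Data.Sum using (inj₁; inj₂)
open import Data.Empty using (⊥; ⊥-elim)
open import Data.List using (List; []; _∷_; _++_; map; length; downFrom; cartesianProductWith)
open import Data.List.Properties using (∷-injective; length-map; length-downFrom)
open import Data.List.Membership.Propositional using (_∈_)
open import Data.List.Relation.Unary.Any using (here; there)
open import Data.List.Membership.Propositional.Properties
  using (∈-++⁺ˡ; ∈-++⁺ʳ; ∈-map⁺; ∈-map⁻; ∈-downFrom⁺; ∈-cartesianProductWith⁺)
open import Relation.Nullary using (¬_; yes; no)
open import Relation.Unary using (Pred)
open import Relation.Binary.PropositionalEquality using (_≡_; refl; sym; trans; cong; subst)
open import Function using (_∘′_)
open import Function.Bundles using (_↔_; Inverse; Injection; Equivalence; mk⇔)
open import Function.Properties.Inverse using (Inverse⇒Injection)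
open import Function.Construct.Composition using (_↔-∘_)
open import Function.Construct.Identity using (↔-id)
open import Function.Construct.Symmetry using (↔-sym)
open import Axiom.ExcludedMiddle using (ExcludedMiddle)

∈⇒≤sum : ∀ {n ns} → n ∈ ns → n ≤ sum ns
∈⇒≤sum {ns = n ∷ ns} (here refl) = m≤m+n n (sum ns)
∈⇒≤sum {ns = m ∷ ns} (there n∈ns) = ≤-trans (∈⇒≤sum n∈ns) (m≤n+m (sum ns) m)

map-≡⇒≡ : ∀ {A B : Set} {f g : A → B} {xs x} → map f xs ≡ map g xs → x ∈ xs → f x ≡ g x
map-≡⇒≡ {xs = _ ∷ _} eq (here refl) = proj₁ (∷-injective eq)
map-≡⇒≡ {xs = _ ∷ _} eq (there x∈xs) = map-≡⇒≡ (proj₂ (∷-injective eq)) x∈xs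

boundedLists : ℕ → ℕ → List (List ℕ)
boundedLists zero    k = [] ∷ []
boundedLists (suc m) k = [] ∷ cartesianProductWith _∷_ (downFrom k) (boundedLists m k)

∈-boundedLists : ∀ m k p → length p ≤ m → (∀ x → x ∈ p → x < k) → p ∈ boundedLists m k
∈-boundedLists zero    k []      _         _ = here refl
∈-boundedLists (suc m) k []      _         _ = here refl
∈-boundedLists (suc m) k (x ∷ p) (s≤s len) bounded =
  there (∈-cartesianProductWith⁺ _∷_ (∈-downFrom⁺ (bounded x (here refl)))
    (∈-boundedLists m k p len (λ y y∈p → bounded y (there y∈p))))

∈-boundedLists-weight : ∀ {p n} → length p + sum p ≤ n → p ∈ boundedLists n (suc n)
∈-boundedLists-weight {p} {n} w≤n = ∈-boundedLists n (suc n) p (≤-trans (m≤m+n _ _) w≤n)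
  (λ x x∈p → s≤s (≤-trans (∈⇒≤sum x∈p) (≤-trans (m≤n+m _ _) w≤n)))

data Term (G : Set) : Set where
  tid   : Term G
  tgen  : G → Term G
  tcomp : Term G → Term G → Term G
  tinv  : Term G → Term G

module Enumeration {G : Set} (weight : G → ℕ) (gens : ℕ → List G)
  (gens-complete : ∀ {g n} → weight g ≤ n → g ∈ gens n) where

  size : Term G → ℕ
  size tid         = 1
  size (tgen g)    = suc (weight g)
  size (tcomp t u) = suc (size t ⊔ size u)
  size (tinv t)    = suc (size t)

  terms : ℕ → List (Term G)
  terms zero    = []
  terms (suc n) = tid ∷ map tgen (gens n) ++ cartesianProductWith tcomp (terms n) (terms n) ++ map tinv (terms n)

  ∈-terms : ∀ {n} t → size t ≤ n → t ∈ terms n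
  ∈-terms {suc n} tid _ = here refl
  ∈-terms {suc n} (tgen g) (s≤s w≤n) = there (∈-++⁺ˡ (∈-map⁺ tgen (gens-complete w≤n)))
  ∈-terms {suc n} (tcomp t u) (s≤s t⊔u≤n) =
    there (∈-++⁺ʳ (map tgen (gens n)) (∈-++⁺ˡ (∈-cartesianProductWith⁺ tcomp
      (∈-terms t (≤-trans (m≤m⊔n (size t) (size u)) t⊔u≤n))
      (∈-terms u (≤-trans (m≤n⊔m (size t) (size u)) t⊔u≤n)))))
  ∈-terms {suc n} (tinv t) (s≤s t≤n) =
    there (∈-++⁺ʳ (map tgen (gens n)) (∈-++⁺ʳ (cartesianProductWith tcomp (terms n) (terms n))
      (∈-map⁺ tinv (∈-terms t t≤n))))

open Inverse

module _ {X : Set} where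

  NonId : Sym X → Set
  NonId g = ¬ (g ≈ₚ ↔-id X)

  ↔-sym-cong : ∀ {a b : Sym X} → a ≈ₚ b → ↔-sym a ≈ₚ ↔-sym b
  ↔-sym-cong {a} {b} a≈b x = begin
    from a x               ≡⟨ cong (from a) (strictlyInverseˡ b x) ⟨
    from a (to b (from b x)) ≡⟨ cong (from a) (a≈b (from b x)) ⟨
    from a (to a (from b x)) ≡⟨ strictlyInverseʳ a (from b x) ⟩
    from b x               ∎
    where open Relation.Binary.PropositionalEquality.≡-Reasoning

  eval : {G : Set} → (G → Sym X) → Term G → Sym X
  eval f tid         = ↔-id X
  eval f (tgen g)    = f g
  eval f (tcomp t u) = eval f t ↔-∘ eval f u
  eval f (tinv t)    = ↔-sym (eval f t)

  ⟨_⟩ : {G : Set} → (G → Sym X) → Pred (Sym X) 0ℓ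
  ⟨ f ⟩ a = Σ (Term _) λ t → eval f t ≈ₚ a

  ⟨⟩-isSubgroup : {G : Set} (f : G → Sym X) → IsSubgroup ⟨ f ⟩
  ⟨⟩-isSubgroup f = record
    { respects  = λ { a≈b (t , t≈a) → t , λ x → trans (t≈a x) (a≈b x) }
    ; has-id    = tid , λ _ → refl
    ; closed-∘  = λ { {a} {b} (t , t≈a) (u , u≈b) →
                      tcomp t u , λ x → trans (cong (to (eval f t)) (u≈b x)) (t≈a (to b x)) }
    ; closed-⁻¹ = λ { {a} (t , t≈a) → tinv t , ↔-sym-cong {eval f t} {a} t≈a }
    }

  ⟨⟩-⊆ : {G : Set} {f : G → Sym X} {A : Pred (Sym X) 0ℓ} →
         IsSubgroup A → (∀ g → A (f g)) → ⟨ f ⟩ ⊆ₚ A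
  ⟨⟩-⊆ {f = f} {A} A-subgroup f∈A a (t , t≈a) = respects t≈a (eval∈A t)
    where
    open IsSubgroup A-subgroup
    eval∈A : ∀ t → A (eval f t)
    eval∈A tid         = has-id
    eval∈A (tgen g)    = f∈A g
    eval∈A (tcomp t u) = closed-∘ (eval∈A t) (eval∈A u)
    eval∈A (tinv t)    = closed-⁻¹ (eval∈A t)

  MovesOutOf : Sym X → Pred X 0ℓ → Set
  MovesOutOf g S = Σ X λ x → S x × ¬ S (to g x)

  ⟨⟩-movesOutOf : {G : Set} {f : G → Sym X} {S : Pred X 0ℓ} →
    (∀ t → NonId (eval f t) → MovesOutOf (eval f t) S) → ∀ b → ⟨ f ⟩ b → NonId b → MovesOutOf b S
  ⟨⟩-movesOutOf {S = S} moves b (t , t≈b) b-nonId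
    with moves t (λ t≈id → b-nonId λ x → trans (sym (t≈b x)) (t≈id x))
  ... | x , Sx , ¬Stx = x , Sx , λ Sbx → ¬Stx (subst S (sym (t≈b x)) Sbx)

  no-proper-strongly-orbit-equivalent : {B : Pred (Sym X) 0ℓ} (S : Pred X 0ℓ) → IsSubgroup B →
    (∀ b → B b → NonId b → MovesOutOf b S) →
    ¬ (Σ (Pred (Sym X) 0ℓ) λ C → ProperSubgroup C B × StronglyOrbitEquivalent B C)
  no-proper-strongly-orbit-equivalent S B-subgroup moves (C , (C-subgroup , C⊆B , b , Bb , b∉C) , soe) =
    g-stays-in-S (moves g (closed-∘ (closed-⁻¹ (C⊆B c Cc)) Bb) g-nonId)
    where
    open IsSubgroup B-subgroup
    bS : Pred X 0ℓ
    bS y = Σ X λ x → S x × to b x ≡ y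
    c-with-image-bS : Σ (Sym X) λ c → C c × MapsTo c S bS
    c-with-image-bS = Equivalence.to (soe S bS) (b , Bb , λ _ → mk⇔ (λ z → z) (λ z → z))
    c : Sym X
    c = proj₁ c-with-image-bS
    Cc : C c
    Cc = proj₁ (proj₂ c-with-image-bS)
    g : Sym X
    g = ↔-sym c ↔-∘ b
    g-nonId : NonId g
    g-nonId g≈id = b∉C (IsSubgroup.respects C-subgroup c≈b Cc)
      where
      c≈b : c ≈ₚ b
      c≈b x = trans (cong (to c) (sym (g≈id x))) (strictlyInverseˡ c (to b x))
    g-stays-in-S : ¬ MovesOutOf g S
    g-stays-in-S (x , Sx , ¬Sgx)
      with Equivalence.to (proj₂ (proj₂ c-with-image-bS) (to b x)) (x , Sx , refl)
    ... | x′ , Sx′ , cx′≡bx = ¬Sgx (subst S (trans (sym (strictlyInverseʳ c x′)) (cong (from c) cx′≡bx)) Sx′)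

module _ {X : Set} (lem : ExcludedMiddle 0ℓ) where

  infinite-avoids : {P : Pred X 0ℓ} → Infinite P → (D : List X) → Σ X λ x → P x × ¬ x ∈ D
  infinite-avoids {P} P-infinite D with lem {Σ X λ x → P x × ¬ x ∈ D}
  ... | yes found = found
  ... | no none = ⊥-elim (P-infinite (D , covered))
    where
    covered : ∀ x → P x → x ∈ D
    covered x Px with lem {x ∈ D}
    ... | yes x∈D = x∈D
    ... | no x∉D = ⊥-elim (none (x , Px , x∉D))

  moved-point-avoiding : {g : Sym X} → Infinite (support g) → (D : List X) →
    Σ X λ x → ¬ to g x ≡ x × ¬ x ∈ D × ¬ to g x ∈ D
  moved-point-avoiding {g} g-infinite D with infinite-avoids g-infinite (D ++ map (from g) D)
  ... | x , gx≢x , x∉D′ = x , gx≢x , x∉D , gx∉D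
    where
    x∉D : ¬ x ∈ D
    x∉D x∈D = x∉D′ (∈-++⁺ˡ x∈D)
    gx∉D : ¬ to g x ∈ D
    gx∉D gx∈D = x∉D′ (∈-++⁺ʳ D (subst (_∈ map (from g) D) (strictlyInverseʳ g x) (∈-map⁺ (from g) gx∈D)))

  record Stage : Set where
    field
      inside outside : List X
      disjoint : ∀ {y} → y ∈ inside → y ∈ outside → ⊥
  open Stage

  record _⊑_ (s t : Stage) : Set where
    constructor mk⊑
    field
      inside-⊆  : ∀ {y} → y ∈ inside s → y ∈ inside t
      outside-⊆ : ∀ {y} → y ∈ outside s → y ∈ outside t
  open _⊑_

  ⊑-refl : ∀ {s} → s ⊑ s
  ⊑-refl = mk⊑ (λ y∈s → y∈s) (λ y∈s → y∈s)

  ⊑-trans : ∀ {s t u} → s ⊑ t → t ⊑ u → s ⊑ u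
  ⊑-trans s⊑t t⊑u = mk⊑ (λ y∈s → inside-⊆ t⊑u (inside-⊆ s⊑t y∈s)) (λ y∈s → outside-⊆ t⊑u (outside-⊆ s⊑t y∈s))

  Separates : Sym X → Stage → Set
  Separates g s = Σ X λ x → x ∈ inside s × to g x ∈ outside s

  separates-⊑ : ∀ {g s t} → s ⊑ t → Separates g s → Separates g t
  separates-⊑ s⊑t (x , x-in , gx-out) = x , inside-⊆ s⊑t x-in , outside-⊆ s⊑t gx-out

  separate : {g : Sym X} → (NonId g → Infinite (support g)) → (s : Stage) →
    Σ Stage λ t → s ⊑ t × (NonId g → Separates g t)
  separate {g} infinite s with lem {NonId g}
  ... | no g-id = s , ⊑-refl , λ g-nonId → ⊥-elim (g-id g-nonId)
  ... | yes g-nonId with moved-point-avoiding {g} (infinite g-nonId) (inside s ++ outside s)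
  ... | x , gx≢x , x-new , gx-new =
    record { inside = x ∷ inside s ; outside = to g x ∷ outside s ; disjoint = disjoint′ } ,
    mk⊑ there there , λ _ → x , here refl , here refl
    where
    disjoint′ : ∀ {y} → y ∈ x ∷ inside s → y ∈ to g x ∷ outside s → ⊥
    disjoint′ (here refl)  (here x≡gx)  = gx≢x (sym x≡gx)
    disjoint′ (here refl)  (there x-out) = x-new (∈-++⁺ʳ (inside s) x-out)
    disjoint′ (there gx-in) (here refl)  = gx-new (∈-++⁺ˡ gx-in)
    disjoint′ (there y-in) (there y-out) = disjoint s y-in y-out

  separate-all : (gs : List (Sym X)) → (∀ {g} → g ∈ gs → NonId g → Infinite (support g)) →
    (s : Stage) → Σ Stage λ t → s ⊑ t × (∀ {g} → g ∈ gs → NonId g → Separates g t)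
  separate-all []       _        s = s , ⊑-refl , λ ()
  separate-all (g ∷ gs) infinite s with separate {g} (infinite (here refl)) s
  ... | t , s⊑t , g-sep with separate-all gs (λ g∈gs → infinite (there g∈gs)) t
  ... | u , t⊑u , gs-sep = u , ⊑-trans s⊑t t⊑u , λ
    { (here refl)  g-nonId → separates-⊑ {g} t⊑u (g-sep g-nonId)
    ; (there h∈gs) h-nonId → gs-sep h∈gs h-nonId }

  -- Since the stages increase and each is disjoint, a point once put outside never enters S.
  separating-set : (gs : ℕ → List (Sym X)) → (∀ {n g} → g ∈ gs n → NonId g → Infinite (support g)) →
    Σ (Pred X 0ℓ) λ S → ∀ {n g} → g ∈ gs n → NonId g → MovesOutOf g S
  separating-set gs infinite = S , moves-out
    where
    next : ∀ n (s : Stage) → Σ Stage λ t → s ⊑ t × (∀ {g} → g ∈ gs n → NonId g → Separates g t)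
    next n = separate-all (gs n) infinite

    stage : ℕ → Stage
    stage zero    = record { inside = [] ; outside = [] ; disjoint = λ () }
    stage (suc n) = proj₁ (next n (stage n))

    stage-mono : ∀ {m n} → m ≤′ n → stage m ⊑ stage n
    stage-mono ≤′-refl = ⊑-refl
    stage-mono {n = suc n} (≤′-step m≤n) = ⊑-trans (stage-mono m≤n) (proj₁ (proj₂ (next n (stage n))))

    S : Pred X 0ℓ
    S y = Σ ℕ λ n → y ∈ inside (stage n)

    outside⇒∉S : ∀ {n y} → y ∈ outside (stage n) → ¬ S y
    outside⇒∉S {n} y-out (m , y-in) with ≤-total m n
    ... | inj₁ m≤n = disjoint (stage n) (inside-⊆ (stage-mono (≤⇒≤′ m≤n)) y-in) y-out
    ... | inj₂ n≤m = disjoint (stage m) y-in (outside-⊆ (stage-mono (≤⇒≤′ n≤m)) y-out)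

    moves-out : ∀ {n g} → g ∈ gs n → NonId g → MovesOutOf g S
    moves-out {n} g∈gs g-nonId with proj₂ (proj₂ (next n (stage n))) g∈gs g-nonId
    ... | x , x-in , gx-out = x , (suc n , x-in) , outside⇒∉S {suc n} gx-out

module PrefixWitnesses (lem : ExcludedMiddle 0ℓ) {X : Set} (e : X ↔ ℕ)
  (A : Pred (Sym X) 0ℓ) (A-subgroup : IsSubgroup A) where

  code : Sym X → ℕ → ℕ
  code a i = to e (to a (from e i))

  prefix : Sym X → ℕ → List ℕ
  prefix a m = map (code a) (downFrom m)

  Realises : Sym X → List ℕ → Set
  Realises a p = prefix a (length p) ≡ p

  -- When no element of A realises p the witness is the identity.
  choose : (p : List ℕ) → Σ (Sym X) λ c → A c × (Σ (Sym X) (λ a → A a × Realises a p) → Realises c p)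
  choose p with lem {Σ (Sym X) λ a → A a × Realises a p}
  ... | yes (a , Aa , a-realises) = a , Aa , λ _ → a-realises
  ... | no none = ↔-id X , IsSubgroup.has-id A-subgroup , λ some → ⊥-elim (none some)

  witness : List ℕ → Sym X
  witness p = proj₁ (choose p)

  witness-∈A : ∀ p → A (witness p)
  witness-∈A p = proj₁ (proj₂ (choose p))

  witness-agrees : ∀ {a} m → A a → ∀ y → to e y < m → to a y ≡ to (witness (prefix a m)) y
  witness-agrees {a} m Aa y y<m = Injection.injective (Inverse⇒Injection e) (begin
    to e (to a y)      ≡⟨ code-to a ⟨
    code a (to e y)    ≡⟨ map-≡⇒≡ prefixes-equal (∈-downFrom⁺ y<m) ⟨
    code c (to e y)    ≡⟨ code-to c ⟩
    to e (to c y)      ∎)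
    where
    open Relation.Binary.PropositionalEquality.≡-Reasoning
    p = prefix a m
    c = witness p
    length-p : length p ≡ m
    length-p = trans (length-map (code a) (downFrom m)) (length-downFrom m)
    code-to : ∀ b → code b (to e y) ≡ to e (to b y)
    code-to b = cong (to e ∘′ to b) (strictlyInverseʳ e y)
    prefixes-equal : prefix c m ≡ p
    prefixes-equal = subst (λ k → prefix c k ≡ p) length-p
      (proj₂ (proj₂ (choose p)) (a , Aa , cong (prefix a) length-p))

  ⟨witness⟩-dense : ∀ a → A a → ∀ (Y : List X) →
    Σ (Sym X) λ b → ⟨ witness ⟩ b × (∀ y → y ∈ Y → to a y ≡ to b y)
  ⟨witness⟩-dense a Aa Y = witness (prefix a m) , (tgen (prefix a m) , λ _ → refl) ,
    λ y y∈Y → witness-agrees m Aa y (s≤s (∈⇒≤sum (∈-map⁺ (to e) y∈Y)))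
    where
    m = suc (sum (map (to e) Y))

corollary4p5 : ExcludedMiddle 0ℓ → ExcludedMiddle (lsuc 0ℓ) →
    (X : Set) → X ↔ ℕ →
    (A : Pred (Sym X) 0ℓ) → IsSubgroup A → InfiniteMinimalDegree A →
    Σ (Pred (Sym X) 0ℓ) λ B →
      IsSubgroup B × (B ⊆ₚ A) × SameSet A (cl A B) ×
      ¬ (Σ (Pred (Sym X) 0ℓ) λ C → ProperSubgroup C B × StronglyOrbitEquivalent B C)
corollary4p5 lem _ X e A A-subgroup A-imd =
  ⟨ witness ⟩ , ⟨⟩-isSubgroup witness , B⊆A ,
  ((λ a Aa → Aa , ⟨witness⟩-dense a Aa) , (λ _ → proj₁)) ,
  no-proper-strongly-orbit-equivalent S (⟨⟩-isSubgroup witness) B-moves-out-of-S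
  where
  open PrefixWitnesses lem e A A-subgroup
  open Enumeration (λ p → length p + sum p) (λ n → boundedLists n (suc n)) ∈-boundedLists-weight

  B⊆A : ⟨ witness ⟩ ⊆ₚ A
  B⊆A = ⟨⟩-⊆ A-subgroup witness-∈A

  enumerated-infinite : ∀ {n g} → g ∈ map (eval witness) (terms n) → NonId g → Infinite (support g)
  enumerated-infinite g∈ with ∈-map⁻ (eval witness) g∈
  ... | t , _ , refl = A-imd (eval witness t) (B⊆A _ (t , λ _ → refl))

  separation : Σ (Pred X 0ℓ) λ S → ∀ {n g} → g ∈ map (eval witness) (terms n) → NonId g → MovesOutOf g S
  separation = separating-set lem (λ n → map (eval witness) (terms n)) enumerated-infinite
  S : Pred X 0ℓ
  S = proj₁ separation

  B-moves-out-of-S : ∀ b → ⟨ witness ⟩ b → NonId b → MovesOutOf b S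
  B-moves-out-of-S = ⟨⟩-movesOutOf λ t → proj₂ separation (∈-map⁺ (eval witness) (∈-terms {size t} t ≤-refl))
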